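{- Let $\Upsilon$ be a set of positions closed under disjunctive sum such that every $\xi\in\Upsilon$ is all-small, and $*\in\Upsilon$. Then $*+*\equiv 0\pmod{\mathrm{cl}(\Upsilon)}$.
   Context: A position $\xi=\{\xi^L \mid \xi^R\}$ is given recursively by finite sets of Left and Right options; $0=\{\cdot\mid\cdot\}$, $*=\{0\mid 0\}$. A position is all-small if Left can move in it iff Right can, and every option is all-small. Disjunctive sum: $\alpha+\beta=\{\alpha^L+\beta,\alpha+\beta^L \mid \alpha^R+\beta,\alpha+\beta^R\}$. Under misère play a player unable to move on their turn wins; $o^-$ denotes misère outcome ($\mathcal{L}$, $\mathcal{R}$, $\mathcal{N}$ next player wins, $\mathcal{P}$ next player loses). $\mathrm{cl}(\Upsilon)$ is the smallest set containing $\Upsilon$ closed under disjunctive sum and taking options. For a closed set $\Gamma$ and $\alpha,\beta\in\Gamma$, $\alpha\equiv\beta\pmod\Gamma$ means $o^-(\alpha+\gamma)=o^-(\beta+\gamma)$ for all $\gamma\in\Gamma$. -}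

module Defs where

open import Data.List using (List; []; _∷_; _++_; null)
open import Data.List.Relation.Unary.All using (All)
open import Data.List.Membership.Propositional using (_∈_)
open import Data.Bool using (Bool; true; false; _∨_; _∧_; not)
open import Data.Product using (_×_)
open import Relation.Binary.PropositionalEquality using (_≡_)

data Game : Set where
  ⟨_∣_⟩ : List Game → List Game → Game

leftOpts : Game → List Game
leftOpts ⟨ L ∣ R ⟩ = L

rightOpts : Game → List Game
rightOpts ⟨ L ∣ R ⟩ = R

zero′ : Game
zero′ = ⟨ [] ∣ [] ⟩

star : Game
star = ⟨ zero′ ∷ [] ∣ zero′ ∷ [] ⟩

mutual
  _⊕_ : Game → Game → Game
  a@(⟨ La ∣ Ra ⟩) ⊕ b@(⟨ Lb ∣ Rb ⟩) =
    ⟨ addˡ La b ++ addʳ a Lb ∣ addˡ Ra b ++ addʳ a Rb ⟩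

  addˡ : List Game → Game → List Game
  addˡ [] b = []
  addˡ (x ∷ xs) b = (x ⊕ b) ∷ addˡ xs b

  addʳ : Game → List Game → List Game
  addʳ a [] = []
  addʳ a (y ∷ ys) = (a ⊕ y) ∷ addʳ a ys

infixl 6 _⊕_

-- Misère play: a player unable to move on their turn wins.
-- leftFirst g  : Left, moving first in g, wins.
-- leftSecond g : Left wins when Right moves first in g.
-- rightFirst / rightSecond symmetric.
mutual
  leftFirst : Game → Bool
  leftFirst ⟨ [] ∣ R ⟩ = true
  leftFirst ⟨ l ∷ L ∣ R ⟩ = anyLeftSecond (l ∷ L)

  leftSecond : Game → Bool
  leftSecond ⟨ L ∣ [] ⟩ = false
  leftSecond ⟨ L ∣ r ∷ R ⟩ = allLeftFirst (r ∷ R)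

  anyLeftSecond : List Game → Bool
  anyLeftSecond [] = false
  anyLeftSecond (g ∷ gs) = leftSecond g ∨ anyLeftSecond gs

  allLeftFirst : List Game → Bool
  allLeftFirst [] = true
  allLeftFirst (g ∷ gs) = leftFirst g ∧ allLeftFirst gs

mutual
  rightFirst : Game → Bool
  rightFirst ⟨ L ∣ [] ⟩ = true
  rightFirst ⟨ L ∣ r ∷ R ⟩ = anyRightSecond (r ∷ R)

  rightSecond : Game → Bool
  rightSecond ⟨ [] ∣ R ⟩ = false
  rightSecond ⟨ l ∷ L ∣ R ⟩ = allRightFirst (l ∷ L)

  anyRightSecond : List Game → Bool
  anyRightSecond [] = false
  anyRightSecond (g ∷ gs) = rightSecond g ∨ anyRightSecond gs

  allRightFirst : List Game → Bool
  allRightFirst [] = true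
  allRightFirst (g ∷ gs) = rightFirst g ∧ allRightFirst gs

data Outcome : Set where
  𝓛 𝓡 𝓝 𝓟 : Outcome

outcomeOf : Bool → Bool → Outcome
outcomeOf true  false = 𝓛
outcomeOf false true  = 𝓡
outcomeOf true  true  = 𝓝
outcomeOf false false = 𝓟

o⁻ : Game → Outcome
o⁻ g = outcomeOf (leftFirst g) (rightFirst g)

data AllSmall : Game → Set where
  allSmall : ∀ {L R} → null L ≡ null R → All AllSmall L → All AllSmall R
           → AllSmall ⟨ L ∣ R ⟩

ClosedUnderSum : (Game → Set) → Set
ClosedUnderSum Υ = ∀ a b → Υ a → Υ b → Υ (a ⊕ b)

data cl (Υ : Game → Set) : Game → Set where
  base  : ∀ {g} → Υ g → cl Υ g
  sum   : ∀ {a b} → cl Υ a → cl Υ b → cl Υ (a ⊕ b)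
  leftOpt  : ∀ {g h} → cl Υ g → h ∈ leftOpts g → cl Υ h
  rightOpt : ∀ {g h} → cl Υ g → h ∈ rightOpts g → cl Υ h

_≡_mod_ : Game → Game → (Game → Set) → Set
α ≡ β mod Γ = Γ α × Γ β × (∀ γ → Γ γ → o⁻ (α ⊕ γ) ≡ o⁻ (β ⊕ γ))

-- Write S = *+*.  Since 0 is the identity for ⊕, S is (definitionally)
-- {*,* | *,*}.  For an all-small game g with moves, Left moving first in S+g
-- either plays S+gᴸ or plays to *+g, where Right may answer back to g; the
-- misère predicate therefore unfolds to  (lf g ∧ x) ∨ ((lf g ∧ x) ∨ v)  with v
-- the value of Left's moves in S+gᴸ.  By induction on g those moves have the
-- same value as in gᴸ, so v = lf g and the expression collapses to lf g by
-- absorption.  The same holds for all four "first/second player" predicates,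
-- and for g = 0 it is a direct computation; all-smallness rules out the
-- remaining shapes (one side with moves, the other without).
module Submission where

open import Defs
open import Data.List using (List; []; _∷_; _++_; null)
open import Data.List.Relation.Unary.All as All using (All; []; _∷_)
open import Data.List.Relation.Unary.All.Properties using (++⁺)
open import Data.List.Relation.Unary.Any using (here)
open import Data.Bool using (true; false; _∨_; _∧_)
open import Data.Product using (_,_)
open import Relation.Binary.PropositionalEquality
  using (_≡_; refl; cong; cong₂; sym; trans; module ≡-Reasoning)

mutual
  ⊕-identityˡ : ∀ g → zero′ ⊕ g ≡ g
  ⊕-identityˡ ⟨ L ∣ R ⟩ = cong₂ ⟨_∣_⟩ (addʳ-identity L) (addʳ-identity R)

  addʳ-identity : ∀ xs → addʳ zero′ xs ≡ xs
  addʳ-identity []       = refl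
  addʳ-identity (x ∷ xs) = cong₂ _∷_ (⊕-identityˡ x) (addʳ-identity xs)

null-++ : ∀ (xs ys : List Game) → null (xs ++ ys) ≡ (null xs ∧ null ys)
null-++ []       ys = refl
null-++ (x ∷ xs) ys = refl

null-addˡ : ∀ xs b → null (addˡ xs b) ≡ null xs
null-addˡ []       b = refl
null-addˡ (x ∷ xs) b = refl

null-addʳ : ∀ a xs → null (addʳ a xs) ≡ null xs
null-addʳ a []       = refl
null-addʳ a (x ∷ xs) = refl

mutual
  ⊕-allSmall : ∀ {a b} → AllSmall a → AllSmall b → AllSmall (a ⊕ b)
  ⊕-allSmall {⟨ La ∣ Ra ⟩} {b@(⟨ Lb ∣ Rb ⟩)} sa@(allSmall ea la ra) sb@(allSmall eb lb rb) =
    allSmall bothCanMove (++⁺ (addˡ-allSmall la sb) (addʳ-allSmall sa lb))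
                         (++⁺ (addˡ-allSmall ra sb) (addʳ-allSmall sa rb))
    where
    bothCanMove : null (addˡ La b ++ addʳ ⟨ La ∣ Ra ⟩ Lb) ≡ null (addˡ Ra b ++ addʳ ⟨ La ∣ Ra ⟩ Rb)
    bothCanMove = begin
      null (addˡ La b ++ addʳ _ Lb)        ≡⟨ null-++ (addˡ La b) (addʳ _ Lb) ⟩
      null (addˡ La b) ∧ null (addʳ _ Lb)  ≡⟨ cong₂ _∧_ (null-addˡ La b) (null-addʳ _ Lb) ⟩
      null La ∧ null Lb                    ≡⟨ cong₂ _∧_ ea eb ⟩
      null Ra ∧ null Rb                    ≡⟨ sym (cong₂ _∧_ (null-addˡ Ra b) (null-addʳ _ Rb)) ⟩
      null (addˡ Ra b) ∧ null (addʳ _ Rb)  ≡⟨ sym (null-++ (addˡ Ra b) (addʳ _ Rb)) ⟩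
      null (addˡ Ra b ++ addʳ _ Rb)        ∎
      where open ≡-Reasoning

  addˡ-allSmall : ∀ {xs b} → All AllSmall xs → AllSmall b → All AllSmall (addˡ xs b)
  addˡ-allSmall []       sb = []
  addˡ-allSmall (p ∷ ps) sb = ⊕-allSmall p sb ∷ addˡ-allSmall ps sb

  addʳ-allSmall : ∀ {a ys} → AllSmall a → All AllSmall ys → All AllSmall (addʳ a ys)
  addʳ-allSmall sa []       = []
  addʳ-allSmall sa (p ∷ ps) = ⊕-allSmall sa p ∷ addʳ-allSmall sa ps

cl-allSmall : ∀ {Υ} → (∀ ξ → Υ ξ → AllSmall ξ) → ∀ {g} → cl Υ g → AllSmall g
cl-allSmall small (base {g} x)  = small g x
cl-allSmall small (sum a b)     = ⊕-allSmall (cl-allSmall small a) (cl-allSmall small b)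
cl-allSmall small (leftOpt c m) with cl-allSmall small c
... | allSmall _ l _ = All.lookup l m
cl-allSmall small (rightOpt c m) with cl-allSmall small c
... | allSmall _ _ r = All.lookup r m

record Transparent (a g : Game) : Set where
  field
    leftFirst-eq   : leftFirst   (a ⊕ g) ≡ leftFirst   g
    leftSecond-eq  : leftSecond  (a ⊕ g) ≡ leftSecond  g
    rightFirst-eq  : rightFirst  (a ⊕ g) ≡ rightFirst  g
    rightSecond-eq : rightSecond (a ⊕ g) ≡ rightSecond g
open Transparent

module _ {a : Game} where
  anyLeftSecond-cong : ∀ {xs} → All (Transparent a) xs → anyLeftSecond (addʳ a xs) ≡ anyLeftSecond xs
  anyLeftSecond-cong []       = refl
  anyLeftSecond-cong (t ∷ ts) = cong₂ _∨_ (leftSecond-eq t) (anyLeftSecond-cong ts)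

  allLeftFirst-cong : ∀ {xs} → All (Transparent a) xs → allLeftFirst (addʳ a xs) ≡ allLeftFirst xs
  allLeftFirst-cong []       = refl
  allLeftFirst-cong (t ∷ ts) = cong₂ _∧_ (leftFirst-eq t) (allLeftFirst-cong ts)

  anyRightSecond-cong : ∀ {xs} → All (Transparent a) xs → anyRightSecond (addʳ a xs) ≡ anyRightSecond xs
  anyRightSecond-cong []       = refl
  anyRightSecond-cong (t ∷ ts) = cong₂ _∨_ (rightSecond-eq t) (anyRightSecond-cong ts)

  allRightFirst-cong : ∀ {xs} → All (Transparent a) xs → allRightFirst (addʳ a xs) ≡ allRightFirst xs
  allRightFirst-cong []       = refl
  allRightFirst-cong (t ∷ ts) = cong₂ _∧_ (rightFirst-eq t) (allRightFirst-cong ts)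

-- The shapes the predicates of S+g unfold to: the mover's two moves to *+g
-- (whose reply to g gives u) plus her moves in S+gᴸ (giving v) collapse to u
-- once v = u.
absorb-∨ : ∀ {u u′ v} x → u′ ≡ u → v ≡ u → (u′ ∧ x) ∨ ((u′ ∧ x) ∨ v) ≡ u
absorb-∨ {true}  true  refl refl = refl
absorb-∨ {true}  false refl refl = refl
absorb-∨ {false} true  refl refl = refl
absorb-∨ {false} false refl refl = refl

absorb-∧ : ∀ {u u′ v} x → u′ ≡ u → v ≡ u → (u′ ∨ x) ∧ ((u′ ∨ x) ∧ v) ≡ u
absorb-∧ {true}  true  refl refl = refl
absorb-∧ {true}  false refl refl = refl
absorb-∧ {false} true  refl refl = refl
absorb-∧ {false} false refl refl = refl

mutual
  star-star-transparent : ∀ g → AllSmall g → Transparent (star ⊕ star) g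
  star-star-transparent ⟨ [] ∣ [] ⟩ _ = record
    { leftFirst-eq = refl ; leftSecond-eq = refl ; rightFirst-eq = refl ; rightSecond-eq = refl }
  star-star-transparent ⟨ [] ∣ r ∷ R ⟩ (allSmall () _ _)
  star-star-transparent ⟨ l ∷ L ∣ [] ⟩ (allSmall () _ _)
  star-star-transparent g@(⟨ l ∷ L ∣ r ∷ R ⟩) (allSmall _ smallL smallR) = record
    { leftFirst-eq   = absorb-∨ (allLeftFirst   (addʳ star (r ∷ R))) (cong leftFirst   0+g) (anyLeftSecond-cong  tL)
    ; leftSecond-eq  = absorb-∧ (anyLeftSecond  (addʳ star (l ∷ L))) (cong leftSecond  0+g) (allLeftFirst-cong   tR)
    ; rightFirst-eq  = absorb-∨ (allRightFirst  (addʳ star (l ∷ L))) (cong rightFirst  0+g) (anyRightSecond-cong tR)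
    ; rightSecond-eq = absorb-∧ (anyRightSecond (addʳ star (r ∷ R))) (cong rightSecond 0+g) (allRightFirst-cong  tL)
    }
    where
    0+g : zero′ ⊕ g ≡ g
    0+g = ⊕-identityˡ g
    tL : All (Transparent (star ⊕ star)) (l ∷ L)
    tL = star-star-transparent-all smallL
    tR : All (Transparent (star ⊕ star)) (r ∷ R)
    tR = star-star-transparent-all smallR

  star-star-transparent-all : ∀ {xs} → All AllSmall xs → All (Transparent (star ⊕ star)) xs
  star-star-transparent-all []       = []
  star-star-transparent-all (p ∷ ps) = star-star-transparent _ p ∷ star-star-transparent-all ps

star-star-outcome : ∀ γ → AllSmall γ → o⁻ (star ⊕ star ⊕ γ) ≡ o⁻ γ
star-star-outcome γ small = cong₂ outcomeOf (leftFirst-eq t) (rightFirst-eq t)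
  where t = star-star-transparent γ small

corollary4p2p3 : (Υ : Game → Set) → ClosedUnderSum Υ → (∀ ξ → Υ ξ → AllSmall ξ) → Υ star
    → (star ⊕ star) ≡ zero′ mod (cl Υ)
corollary4p2p3 Υ _ small star∈Υ = star+star∈cl , zero∈cl , sameOutcome
  where
  star+star∈cl : cl Υ (star ⊕ star)
  star+star∈cl = sum (base star∈Υ) (base star∈Υ)

  zero∈cl : cl Υ zero′
  zero∈cl = leftOpt (base star∈Υ) (here refl)

  sameOutcome : ∀ γ → cl Υ γ → o⁻ (star ⊕ star ⊕ γ) ≡ o⁻ (zero′ ⊕ γ)
  sameOutcome γ γ∈cl = trans (star-star-outcome γ (cl-allSmall small γ∈cl))
                             (sym (cong o⁻ (⊕-identityˡ γ)))
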